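{- Let $a_0 = 0$ and, for every positive integer $n$, $a_n := \sum_{k=0}^{n-1} k!\,(n-k-1)!$. Then, as formal power series (equivalently, as analytic functions near $0$), $$\sum_{n=0}^{\infty} a_n \frac{x^n}{n!} = \frac{ -2\log(1-x)}{2-x}.$$ -}

module Defs where

open import Data.Nat as ℕ using (ℕ; zero; suc; _∸_; _!)
open import Data.Nat.Properties using (_!≢0)
open import Data.Integer as ℤ using (ℤ; +_)
open import Data.List using (List; map; upTo)
open import Data.Rational as ℚ using (ℚ; 0ℚ; 1ℚ; _/_)

sumℕ : List ℕ → ℕ
sumℕ = Data.List.foldr ℕ._+_ 0

sumℚ : List ℚ → ℚ
sumℚ = Data.List.foldr ℚ._+_ 0ℚ

a : ℕ → ℕ
a zero    = 0
a (suc n) = sumℕ (map (λ k → (k !) ℕ.* ((n ∸ k) !)) (upTo (suc n)))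

FPS : Set
FPS = ℕ → ℚ

_⋆_ : FPS → FPS → FPS
(f ⋆ g) n = sumℚ (map (λ k → f k ℚ.* g (n ∸ k)) (upTo (suc n)))

_·_ : ℚ → FPS → FPS
(c · f) n = c ℚ.* f n

egf : (ℕ → ℕ) → FPS
egf s n = (+ s n) / (n !) where instance _ = n !≢0

twoMinusX : FPS
twoMinusX zero          = ℚ.1ℚ ℚ.+ ℚ.1ℚ
twoMinusX (suc zero)    = ℚ.- ℚ.1ℚ
twoMinusX (suc (suc _)) = 0ℚ

log1-x : FPS
log1-x zero    = 0ℚ
log1-x (suc m) = ℚ.- ((+ 1) / suc m)

-- Multiplied out, the identity says 2 aₘ₊₁/(m+1)! - aₘ/m! = 2/(m+1), i.e. clearing denominators
-- 2 aₘ₊₁ = (m+1) aₘ + 2 m!.  Since aₙ₊₁ = Σ_{i+j=n} i! j!, this follows by summing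
-- (i+1)! j! + i! (j+1)! = (i+j+2) i! j! over the antidiagonal i + j = n: each of the two sums on
-- the left is aₙ₊₂ with one boundary term (n+1)! removed, and the right side is (n+2) aₙ₊₁.
module Submission where

open import Algebra.Bundles using (Semiring; CommutativeRing)
open import Data.Nat as ℕ using (ℕ; zero; suc; _∸_; _!)
import Data.Nat.Properties as ℕ
open import Data.List using (foldr; map; applyUpTo; upTo)
open import Data.List.Properties using (map-upTo)
open import Relation.Binary.PropositionalEquality as ≡ using (_≡_)
open import Defs

module AntidiagonalSum {c ℓ} (R : Semiring c ℓ) where
  open Semiring R
  open import Algebra.Properties.CommutativeSemigroup +-commutativeSemigroup using (interchange)
  open import Relation.Binary.Reasoning.Setoid setoid

  antidiagonalSum : (ℕ → ℕ → Carrier) → ℕ → Carrier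
  antidiagonalSum g zero    = g 0 0
  antidiagonalSum g (suc n) = g 0 (suc n) + antidiagonalSum (λ i j → g (suc i) j) n

  foldr-upTo≈antidiagonalSum : ∀ g n →
    foldr _+_ 0# (map (λ k → g k (n ∸ k)) (upTo (suc n))) ≈ antidiagonalSum g n
  foldr-upTo≈antidiagonalSum g n =
    trans (reflexive (≡.cong (foldr _+_ 0#) (map-upTo (λ k → g k (n ∸ k)) (suc n)))) (applied g n)
    where
    applied : ∀ g n → foldr _+_ 0# (applyUpTo (λ k → g k (n ∸ k)) (suc n)) ≈ antidiagonalSum g n
    applied g zero    = +-identityʳ (g 0 0)
    applied g (suc n) = +-congˡ (applied (λ i j → g (suc i) j) n)

  antidiagonalSum-cong : ∀ {g h} n → (∀ i j → i ℕ.+ j ≡ n → g i j ≈ h i j) →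
                         antidiagonalSum g n ≈ antidiagonalSum h n
  antidiagonalSum-cong zero    g≈h = g≈h 0 0 ≡.refl
  antidiagonalSum-cong (suc n) g≈h =
    +-cong (g≈h 0 (suc n) ≡.refl)
           (antidiagonalSum-cong n (λ i j i+j≡n → g≈h (suc i) j (≡.cong suc i+j≡n)))

  antidiagonalSum-suc : ∀ g n →
    antidiagonalSum g (suc n) ≈ antidiagonalSum (λ i j → g i (suc j)) n + g (suc n) 0
  antidiagonalSum-suc g zero    = refl
  antidiagonalSum-suc g (suc n) = begin
    g 0 (suc (suc n)) + antidiagonalSum (λ i j → g (suc i) j) (suc n)
      ≈⟨ +-congˡ (antidiagonalSum-suc (λ i j → g (suc i) j) n) ⟩
    g 0 (suc (suc n)) + (antidiagonalSum (λ i j → g (suc i) (suc j)) n + g (suc (suc n)) 0)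
      ≈⟨ +-assoc _ _ _ ⟨
    antidiagonalSum (λ i j → g i (suc j)) (suc n) + g (suc (suc n)) 0 ∎

  antidiagonalSum-zero : ∀ n → antidiagonalSum (λ _ _ → 0#) n ≈ 0#
  antidiagonalSum-zero zero    = refl
  antidiagonalSum-zero (suc n) = trans (+-identityˡ _) (antidiagonalSum-zero n)

  antidiagonalSum-suc-linear : ∀ g → (∀ i j → g i (2 ℕ.+ j) ≈ 0#) → ∀ n →
                               antidiagonalSum g (suc n) ≈ g n 1 + g (suc n) 0
  antidiagonalSum-suc-linear g g≈0 n = trans (antidiagonalSum-suc g n) (+-congʳ (shifted n))
    where
    shifted : ∀ n → antidiagonalSum (λ i j → g i (suc j)) n ≈ g n 1
    shifted zero    = refl
    shifted (suc n) = begin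
      antidiagonalSum (λ i j → g i (suc j)) (suc n)
        ≈⟨ antidiagonalSum-suc (λ i j → g i (suc j)) n ⟩
      antidiagonalSum (λ i j → g i (2 ℕ.+ j)) n + g (suc n) 1
        ≈⟨ +-congʳ (trans (antidiagonalSum-cong n (λ i j _ → g≈0 i j)) (antidiagonalSum-zero n)) ⟩
      0# + g (suc n) 1
        ≈⟨ +-identityˡ _ ⟩
      g (suc n) 1 ∎

  antidiagonalSum-+ : ∀ g h n → antidiagonalSum (λ i j → g i j + h i j) n ≈
                                antidiagonalSum g n + antidiagonalSum h n
  antidiagonalSum-+ g h zero    = refl
  antidiagonalSum-+ g h (suc n) =
    trans (+-congˡ (antidiagonalSum-+ (λ i j → g (suc i) j) (λ i j → h (suc i) j) n))
          (interchange _ _ _ _)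

  antidiagonalSum-*ˡ : ∀ x g n → antidiagonalSum (λ i j → x * g i j) n ≈ x * antidiagonalSum g n
  antidiagonalSum-*ˡ x g zero    = refl
  antidiagonalSum-*ˡ x g (suc n) =
    trans (+-congˡ (antidiagonalSum-*ˡ x (λ i j → g (suc i) j) n)) (sym (distribˡ x _ _))

module FactorialConvolution where
  open import Data.Nat using (_+_; _*_)
  open import Data.Nat.Tactic.RingSolver using (solve-∀)
  open AntidiagonalSum ℕ.+-*-semiring
  open ≡ using (refl; cong; sym; trans)
  open ≡.≡-Reasoning

  !-product : ℕ → ℕ → ℕ
  !-product i j = i ! * j !

  !-product-suc : ∀ i j →
    !-product (suc i) j + !-product i (suc j) ≡ (2 + (i + j)) * !-product i j
  !-product-suc i j = identity i j (i !) (j !)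
    where
    identity : ∀ i j x y → suc i * x * y + x * (suc j * y) ≡ (2 + (i + j)) * (x * y)
    identity = solve-∀

  a≡antidiagonalSum : ∀ n → a (suc n) ≡ antidiagonalSum !-product n
  a≡antidiagonalSum = foldr-upTo≈antidiagonalSum !-product

  !-product-sum-recurrence : ∀ n →
    2 * antidiagonalSum !-product (suc n) ≡
    (2 + n) * antidiagonalSum !-product n + 2 * suc n !
  !-product-sum-recurrence n = begin
    2 * S (suc n)
      -- 2 * x unfolds to x + (x + 0); the first copy splits off its first term, the second its last.
      ≡⟨ cong (λ x → S (suc n) + (x + 0)) (antidiagonalSum-suc !-product n) ⟩
    (1 * suc n ! + L) + ((R + suc n ! * 1) + 0)
      ≡⟨ rearrange (suc n !) L R ⟩
    (L + R) + 2 * suc n !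
      ≡⟨ cong (_+ 2 * suc n !) (sym (antidiagonalSum-+ (λ i j → !-product (suc i) j)
                                                      (λ i j → !-product i (suc j)) n)) ⟩
    antidiagonalSum (λ i j → !-product (suc i) j + !-product i (suc j)) n + 2 * suc n !
      ≡⟨ cong (_+ 2 * suc n !) (antidiagonalSum-cong n (λ i j i+j≡n →
           trans (!-product-suc i j) (cong (λ k → (2 + k) * !-product i j) i+j≡n))) ⟩
    antidiagonalSum (λ i j → (2 + n) * !-product i j) n + 2 * suc n !
      ≡⟨ cong (_+ 2 * suc n !) (antidiagonalSum-*ˡ (2 + n) !-product n) ⟩
    (2 + n) * S n + 2 * suc n ! ∎
    where
    S : ℕ → ℕ
    S = antidiagonalSum !-product
    L R : ℕ
    L = antidiagonalSum (λ i j → !-product (suc i) j) n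
    R = antidiagonalSum (λ i j → !-product i (suc j)) n
    rearrange : ∀ f l r → (1 * f + l) + ((r + f * 1) + 0) ≡ (l + r) + 2 * f
    rearrange = solve-∀

  a-recurrence : ∀ m → 2 * a (suc m) ≡ suc m * a m + 2 * m !
  a-recurrence zero    = refl
  a-recurrence (suc n) rewrite a≡antidiagonalSum (suc n) | a≡antidiagonalSum n =
    !-product-sum-recurrence n

open FactorialConvolution using (a-recurrence)

-- Opened only here: the modules above use the ℕ and semiring versions of _+_ and _*_.
open import Data.Rational using (ℚ; 0ℚ; 1ℚ; -_; _+_; _-_; _*_; _/_; fromℚᵘ; toℚᵘ)
open import Data.Rational.Properties as ℚ
  using (fromℚᵘ-cong; toℚᵘ-fromℚᵘ; fromℚᵘ-toℚᵘ; toℚᵘ-homo-+; toℚᵘ-homo-*)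
open import Data.Rational.Solver using (module +-*-Solver)
open import Data.Rational.Unnormalised as ℚᵘ using (mkℚᵘ; *≡*)
import Data.Rational.Unnormalised.Properties as ℚᵘ
open import Data.Integer as ℤ using (+_)
import Data.Integer.Properties as ℤ
open ≡ using (refl; cong; cong₂; sym; trans)
open ≡.≡-Reasoning

fromℚᵘ-homo-+ : ∀ p q → fromℚᵘ (p ℚᵘ.+ q) ≡ fromℚᵘ p + fromℚᵘ q
fromℚᵘ-homo-+ p q = begin
  fromℚᵘ (p ℚᵘ.+ q)
    ≡⟨ fromℚᵘ-cong (ℚᵘ.+-cong (ℚᵘ.≃-sym (toℚᵘ-fromℚᵘ p)) (ℚᵘ.≃-sym (toℚᵘ-fromℚᵘ q))) ⟩
  fromℚᵘ (toℚᵘ (fromℚᵘ p) ℚᵘ.+ toℚᵘ (fromℚᵘ q))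
    ≡⟨ fromℚᵘ-cong (ℚᵘ.≃-sym (toℚᵘ-homo-+ (fromℚᵘ p) (fromℚᵘ q))) ⟩
  fromℚᵘ (toℚᵘ (fromℚᵘ p + fromℚᵘ q))
    ≡⟨ fromℚᵘ-toℚᵘ _ ⟩
  fromℚᵘ p + fromℚᵘ q ∎

fromℚᵘ-homo-* : ∀ p q → fromℚᵘ (p ℚᵘ.* q) ≡ fromℚᵘ p * fromℚᵘ q
fromℚᵘ-homo-* p q = begin
  fromℚᵘ (p ℚᵘ.* q)
    ≡⟨ fromℚᵘ-cong (ℚᵘ.*-cong (ℚᵘ.≃-sym (toℚᵘ-fromℚᵘ p)) (ℚᵘ.≃-sym (toℚᵘ-fromℚᵘ q))) ⟩
  fromℚᵘ (toℚᵘ (fromℚᵘ p) ℚᵘ.* toℚᵘ (fromℚᵘ q))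
    ≡⟨ fromℚᵘ-cong (ℚᵘ.≃-sym (toℚᵘ-homo-* (fromℚᵘ p) (fromℚᵘ q))) ⟩
  fromℚᵘ (toℚᵘ (fromℚᵘ p * fromℚᵘ q))
    ≡⟨ fromℚᵘ-toℚᵘ _ ⟩
  fromℚᵘ p * fromℚᵘ q ∎

fromℕ : ℕ → ℚ
fromℕ n = + n / 1

fromℕ-homo-+ : ∀ m n → fromℕ (m ℕ.+ n) ≡ fromℕ m + fromℕ n
fromℕ-homo-+ m n =
  trans (fromℚᵘ-cong {mkℚᵘ (+ (m ℕ.+ n)) 0} {mkℚᵘ (+ m) 0 ℚᵘ.+ mkℚᵘ (+ n) 0} (*≡* eq))
        (fromℚᵘ-homo-+ (mkℚᵘ (+ m) 0) (mkℚᵘ (+ n) 0))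
  where
  eq : + (m ℕ.+ n) ℤ.* + 1 ≡ (+ m ℤ.* + 1 ℤ.+ + n ℤ.* + 1) ℤ.* + 1
  eq = cong (ℤ._* + 1) (trans (ℤ.pos-+ m n)
                              (sym (cong₂ ℤ._+_ (ℤ.*-identityʳ (+ m)) (ℤ.*-identityʳ (+ n)))))

fromℕ-homo-* : ∀ m n → fromℕ (m ℕ.* n) ≡ fromℕ m * fromℕ n
fromℕ-homo-* m n =
  trans (fromℚᵘ-cong {mkℚᵘ (+ (m ℕ.* n)) 0} {mkℚᵘ (+ m) 0 ℚᵘ.* mkℚᵘ (+ n) 0} (*≡* eq))
        (fromℚᵘ-homo-* (mkℚᵘ (+ m) 0) (mkℚᵘ (+ n) 0))
  where
  eq : + (m ℕ.* n) ℤ.* + 1 ≡ (+ m ℤ.* + n) ℤ.* + 1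
  eq = cong (ℤ._* + 1) (ℤ.pos-* m n)

m/n*n≡m : ∀ m n .{{_ : ℕ.NonZero n}} → (+ m / n) * fromℕ n ≡ fromℕ m
m/n*n≡m m (suc k) =
  trans (sym (fromℚᵘ-homo-* (mkℚᵘ (+ m) k) (mkℚᵘ (+ suc k) 0)))
        (fromℚᵘ-cong {mkℚᵘ (+ m) k ℚᵘ.* mkℚᵘ (+ suc k) 0} {mkℚᵘ (+ m) 0} (*≡* eq))
  where
  eq : (+ m ℤ.* + suc k) ℤ.* + 1 ≡ + m ℤ.* + (suc k ℕ.* 1)
  eq = trans (ℤ.*-identityʳ _) (cong (λ t → + m ℤ.* + t) (sym (ℕ.*-identityʳ (suc k))))

*-cancelʳ-invertible : ∀ {x y} u v → u * v ≡ 1ℚ → x * u ≡ y * u → x ≡ y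
*-cancelʳ-invertible {x} {y} u v uv≡1 xu≡yu = begin
  x             ≡⟨ ℚ.*-identityʳ x ⟨
  x * 1ℚ        ≡⟨ cong (x *_) uv≡1 ⟨
  x * (u * v)   ≡⟨ ℚ.*-assoc x u v ⟨
  x * u * v     ≡⟨ cong (_* v) xu≡yu ⟩
  y * u * v     ≡⟨ ℚ.*-assoc y u v ⟩
  y * (u * v)   ≡⟨ cong (y *_) uv≡1 ⟩
  y * 1ℚ        ≡⟨ ℚ.*-identityʳ y ⟩
  y             ∎

⋆-suc-linear : ∀ f p → (∀ j → p (2 ℕ.+ j) ≡ 0ℚ) → ∀ n →
               (f ⋆ p) (suc n) ≡ f n * p 1 + f (suc n) * p 0
⋆-suc-linear f p p≡0 n =
  trans (foldr-upTo≈antidiagonalSum (λ i j → f i * p j) (suc n))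
        (antidiagonalSum-suc-linear (λ i j → f i * p j)
                                    (λ i j → trans (cong (f i *_) (p≡0 j)) (ℚ.*-zeroʳ (f i))) n)
  where open AntidiagonalSum (CommutativeRing.semiring ℚ.+-*-commutativeRing)

egf-recurrence : ∀ s m → 2 ℕ.* s (suc m) ≡ suc m ℕ.* s m ℕ.+ 2 ℕ.* m ! →
                 egf s m * - 1ℚ + egf s (suc m) * (1ℚ + 1ℚ) ≡ - (1ℚ + 1ℚ) * - (+ 1 / suc m)
egf-recurrence s m rec =
  *-cancelʳ-invertible (m+1 * m!) (1/[m+1] * 1/m!) inverse (trans cleared-lhs (sym cleared-rhs))
  where
  open +-*-Solver
  two m+1 m! 1/[m+1] 1/m! : ℚ
  two     = 1ℚ + 1ℚ
  m+1     = fromℕ (suc m)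
  m!      = fromℕ (m !)
  1/[m+1] = + 1 / suc m
  1/m!    = _/_ (+ 1) (m !) {{m ℕ.!≢0}}

  inverse : m+1 * m! * (1/[m+1] * 1/m!) ≡ 1ℚ
  inverse = begin
    m+1 * m! * (1/[m+1] * 1/m!)
      ≡⟨ solve 4 (λ d G r g → d :* G :* (r :* g) := (r :* d) :* (g :* G)) refl m+1 m! 1/[m+1] 1/m! ⟩
    (1/[m+1] * m+1) * (1/m! * m!)
      ≡⟨ cong₂ _*_ (m/n*n≡m 1 (suc m)) (m/n*n≡m 1 (m !) {{m ℕ.!≢0}}) ⟩
    1ℚ ∎

  egf-suc-cleared : egf s (suc m) * (m+1 * m!) ≡ fromℕ (s (suc m))
  egf-suc-cleared = trans (cong (egf s (suc m) *_) (sym (fromℕ-homo-* (suc m) (m !))))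
                          (m/n*n≡m (s (suc m)) (suc m !) {{suc m ℕ.!≢0}})

  egf-cleared : egf s m * m! ≡ fromℕ (s m)
  egf-cleared = m/n*n≡m (s m) (m !) {{m ℕ.!≢0}}

  recurrence : two * fromℕ (s (suc m)) ≡ m+1 * fromℕ (s m) + two * m!
  recurrence = begin
    two * fromℕ (s (suc m))                   ≡⟨ fromℕ-homo-* 2 (s (suc m)) ⟨
    fromℕ (2 ℕ.* s (suc m))                   ≡⟨ cong fromℕ rec ⟩
    fromℕ (suc m ℕ.* s m ℕ.+ 2 ℕ.* m !)       ≡⟨ fromℕ-homo-+ (suc m ℕ.* s m) (2 ℕ.* m !) ⟩
    fromℕ (suc m ℕ.* s m) + fromℕ (2 ℕ.* m !) ≡⟨ cong₂ _+_ (fromℕ-homo-* (suc m) (s m))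
                                                             (fromℕ-homo-* 2 (m !)) ⟩
    m+1 * fromℕ (s m) + two * m!              ∎

  cleared-lhs : (egf s m * - 1ℚ + egf s (suc m) * two) * (m+1 * m!) ≡ two * m!
  cleared-lhs = begin
    (egf s m * - 1ℚ + egf s (suc m) * two) * (m+1 * m!)
      ≡⟨ solve 4 (λ e₀ e₁ d G → (e₀ :* (:- con 1ℚ) :+ e₁ :* (con 1ℚ :+ con 1ℚ)) :* (d :* G)
                             := (con 1ℚ :+ con 1ℚ) :* (e₁ :* (d :* G)) :- d :* (e₀ :* G))
                 refl (egf s m) (egf s (suc m)) m+1 m! ⟩
    two * (egf s (suc m) * (m+1 * m!)) - m+1 * (egf s m * m!)
      ≡⟨ cong₂ (λ x y → two * x - m+1 * y) egf-suc-cleared egf-cleared ⟩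
    two * fromℕ (s (suc m)) - m+1 * fromℕ (s m)
      ≡⟨ cong (_- m+1 * fromℕ (s m)) recurrence ⟩
    m+1 * fromℕ (s m) + two * m! - m+1 * fromℕ (s m)
      ≡⟨ solve 2 (λ x y → x :+ y :- x := y) refl (m+1 * fromℕ (s m)) (two * m!) ⟩
    two * m! ∎

  cleared-rhs : - two * - 1/[m+1] * (m+1 * m!) ≡ two * m!
  cleared-rhs = begin
    - two * - 1/[m+1] * (m+1 * m!)
      ≡⟨ solve 3 (λ r d G → (:- (con 1ℚ :+ con 1ℚ)) :* (:- r) :* (d :* G)
                          := (con 1ℚ :+ con 1ℚ) :* (r :* d) :* G)
                 refl 1/[m+1] m+1 m! ⟩
    two * (1/[m+1] * m+1) * m!   ≡⟨ cong (λ t → two * t * m!) (m/n*n≡m 1 (suc m)) ⟩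
    two * 1ℚ * m!                ≡⟨ cong (_* m!) (ℚ.*-identityʳ two) ⟩
    two * m!                     ∎

corollary1 : ∀ n → (egf a ⋆ twoMinusX) n ≡ ((- (1ℚ + 1ℚ)) · log1-x) n
corollary1 zero    = refl
corollary1 (suc m) = trans (⋆-suc-linear (egf a) twoMinusX (λ _ → refl) m)
                           (egf-recurrence a m (a-recurrence m))
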